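{- Let $n\ge 1$, let $M\in\mathbb{R}^{n\times n}$ be symmetric positive definite and let $\mathbf{q}\in\mathbb{R}^n$ be generic with respect to $M$. Then, in the D-cube $\mathcal{O}$ defined by $M$ and $\mathbf{q}$, the L-graph of the vertex $\emptyset$ is acyclic.
   Context: Notation: $[n]=\{1,\dots,n\}$ and $U\oplus V$ denotes symmetric difference. An $n$-cube orientation is a directed graph with vertex set $2^{[n]}$ containing, for every $V\subseteq[n]$ and $i\in[n]$, exactly one of the edges $(V,V\oplus\{i\})$, $(V\oplus\{i\},V)$; its outmap is $\phi(V)=\{i: (V,V\oplus\{i\})\text{ is an edge}\}$. The L-graph of $V$ has vertex set $[n]\setminus V$ and an arc $(i,j)$ for distinct $i,j\in[n]\setminus V$ whenever $j\in\phi(V)\oplus\phi(V\cup\{i\})$. For $V\subseteq[n]$, $M(V)$ is the matrix whose $i$-th column is $-M_i$ if $i\in V$ and the $i$-th identity column $I_i$ if $i\notin V$. $\mathbf{q}$ is generic if no entry of $M(V)^{ -1}\mathbf{q}$ is zero for any $V$. The D-cube defined by symmetric positive definite $M$ and generic $\mathbf{q}$ is the $n$-cube orientation with outmap $\phi(V)=\{i: (M(V)^{ -1}\mathbf{q})_i<0\}$. -}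

module Defs where

open import Data.Nat using (ℕ)
open import Data.Fin using (Fin; zero; suc; _≟_)
open import Data.Fin.Subset using (Subset; ⁅_⁆) renaming (⊥ to ∅)
open import Data.Vec using (lookup)
open import Data.Bool using (Bool; true; false; if_then_else_)
open import Data.Product using (Σ; ∃; _×_; _,_)
open import Data.Sum using (_⊎_)
open import Relation.Nullary using (¬_; yes; no)
open import Relation.Binary.PropositionalEquality using (_≡_; _≢_)
open import Relation.Binary.Structures using (IsStrictTotalOrder)
open import Relation.Binary.Construct.Closure.Transitive using (TransClosure)
open import Algebra.Structures using (IsCommutativeRing)

-- The real numbers, axiomatised as a Dedekind-complete ordered field
-- (agda-stdlib has no reals; we quantify over every model of these axioms).

record RealField : Set₁ where
  infixl 6 _+_
  infixl 7 _*_
  infix 4 _<_ _≤_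
  field
    Carrier : Set
    _+_ _*_ : Carrier → Carrier → Carrier
    -_      : Carrier → Carrier
    0# 1#   : Carrier
    _⁻¹     : Carrier → Carrier
    _<_     : Carrier → Carrier → Set
    isCommutativeRing : IsCommutativeRing _≡_ _+_ _*_ -_ 0# 1#
    0≢1       : 0# ≢ 1#
    ⁻¹-inverse : ∀ x → x ≢ 0# → x * (x ⁻¹) ≡ 1#
    isStrictTotalOrder : IsStrictTotalOrder _≡_ _<_
    +-mono-<  : ∀ x y z → x < y → x + z < y + z
    *-pos     : ∀ x y → 0# < x → 0# < y → 0# < x * y

  _≤_ : Carrier → Carrier → Set
  x ≤ y = x < y ⊎ x ≡ y

  UpperBound : (Carrier → Set) → Carrier → Set
  UpperBound P b = ∀ x → P x → x ≤ b

  field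
    complete : (P : Carrier → Set) → ∃ P → ∃ (UpperBound P) →
               Σ Carrier λ s → UpperBound P s × (∀ b → UpperBound P b → s ≤ b)

module Cube (R : RealField) where
  open RealField R

  sumF : ∀ {n} → (Fin n → Carrier) → Carrier
  sumF {ℕ.zero}  f = 0#
  sumF {ℕ.suc n} f = f zero + sumF (λ i → f (suc i))

  Matrix : ℕ → Set
  Matrix n = Fin n → Fin n → Carrier   -- M i j = entry in row i, column j

  Vector : ℕ → Set
  Vector n = Fin n → Carrier

  _·_ : ∀ {n} → Matrix n → Matrix n → Matrix n
  (A · B) i j = sumF (λ k → A i k * B k j)

  _▷_ : ∀ {n} → Matrix n → Vector n → Vector n
  (A ▷ x) i = sumF (λ k → A i k * x k)

  identity : ∀ {n} → Matrix n
  identity i j with i ≟ j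
  ... | yes _ = 1#
  ... | no  _ = 0#

  IsInverse : ∀ {n} → Matrix n → Matrix n → Set
  IsInverse A B = (∀ i j → (A · B) i j ≡ identity i j) × (∀ i j → (B · A) i j ≡ identity i j)

  Symmetric : ∀ {n} → Matrix n → Set
  Symmetric M = ∀ i j → M i j ≡ M j i

  PositiveDefinite : ∀ {n} → Matrix n → Set
  PositiveDefinite M = ∀ (x : Vector _) → ¬ (∀ i → x i ≡ 0#) →
                       0# < sumF (λ i → x i * (M ▷ x) i)

  M[_] : ∀ {n} → Matrix n → Subset n → Matrix n
  M[ M ] V i j = if lookup V j then - (M i j) else identity i j

  Generic : ∀ {n} → Matrix n → Vector n → Set
  Generic M q = ∀ V B → IsInverse (M[ M ] V) B → ∀ i → (B ▷ q) i ≢ 0#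

  _∈φ[_,_]_ : ∀ {n} → Fin n → Matrix n → Vector n → Subset n → Set
  i ∈φ[ M , q ] V = Σ (Matrix _) λ B → IsInverse (M[ M ] V) B × ((B ▷ q) i < 0#)

  InSymDiff : ∀ {n} → Matrix n → Vector n → Subset n → Subset n → Fin n → Set
  InSymDiff M q U W j = (j ∈φ[ M , q ] U × ¬ (j ∈φ[ M , q ] W))
                      ⊎ (¬ (j ∈φ[ M , q ] U) × j ∈φ[ M , q ] W)

  -- arcs of the L-graph of the vertex ∅ (vertex set [n] ∖ ∅ = all of Fin n):
  -- (i , j) with i ≠ j and j ∈ φ(∅) ⊕ φ(∅ ∪ {i})
  LArc∅ : ∀ {n} → Matrix n → Vector n → Fin n → Fin n → Set
  LArc∅ M q i j = i ≢ j × InSymDiff M q ∅ ⁅ i ⁆ j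

  Acyclic : ∀ {n} → (Fin n → Fin n → Set) → Set
  Acyclic E = ∀ i → ¬ TransClosure E i i

-- Along every arc i → j of the L-graph of ∅ the potential q_k² / M_kk strictly decreases, so
-- the graph has no cycle. At ∅ the outmap is the sign pattern of q, and at ⁅i⁆ it is the sign
-- pattern of the solution y of M(⁅i⁆) y = q, i.e. q_i = -M_ii y_i and q_j = y_j - M_ji y_i.
-- An arc means q_j y_j < 0, and then
--   M_jj (q_i²/M_ii - q_j²/M_jj) = (M_ii M_jj - M_ji²) y_i² - 2 q_j y_j + y_j² > 0,
-- since the 2×2 principal minor of the positive definite M is positive.

module Submission where

open import Algebra.Bundles using (CommutativeRing)
open import Data.Bool using (true; false)
open import Data.Empty using (⊥-elim)
open import Data.Fin using (Fin; zero; suc; _≟_)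
open import Data.Fin.Properties using (suc-injective)
open import Data.Fin.Subset using (⁅_⁆) renaming (⊥ to ∅)
open import Data.Fin.Subset.Properties using (x∈⁅x⁆; x∈⁅y⁆⇒x≡y)
open import Data.Integer.Base as ℤ using (ℤ; +[1+_]; -[1+_]; _⊖_; _◃_; sign; ∣_∣)
open import Data.Integer.Properties using ([1+m]⊖[1+n]≡m⊖n; +◃n≡+n; -◃n≡-n; ◃-inverse)
  renaming (_≟_ to _ℤ≟_)
import Data.Maybe.Base as Maybe
open import Data.Nat.Base as ℕ using (ℕ; zero; suc; _≤_)
open import Data.Nat.Properties using (+-suc)
open import Data.Sign.Base as Sign using (Sign)
open import Data.Sum as Sum using (_⊎_; inj₁; inj₂)
open import Data.Vec using (lookup)
open import Data.Vec.Properties using (lookup-replicate; []=⇒lookup; lookup⇒[]=)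
open import Function.Base using (_∘_)
open import Relation.Binary.Construct.Closure.Transitive using (TransClosure; [_]; _∷_)
open import Relation.Binary.Definitions using (tri<; tri≈; tri>)
import Relation.Binary.PropositionalEquality as ≡
open import Relation.Binary.Structures using (IsStrictTotalOrder)
open import Relation.Nullary using (¬_; yes; no)
open import Relation.Nullary.Decidable using (dec⇒maybe)

open import Defs

-- The ring solver needs coefficients with a decidable equality, which the carrier lacks;
-- ℤ is used instead, interpreted via n ↦ n × 1#. The TCOptimised _×_ is the one with
-- 1 × x = x definitionally, so that constants in solver goals match literally.
module IntegerCoefficients {c ℓ} (R : CommutativeRing c ℓ) where
  open CommutativeRing R
  open import Algebra.Properties.Ring ring using (-1*x≈-x; -‿involutive; -0#≈0#; -‿+-comm)
  open import Algebra.Properties.Semiring.Mult.TCOptimised semiring using (_×_; ×-homo-+; ×1-homo-*)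
  open import Algebra.Properties.CommutativeSemigroup +-commutativeSemigroup
    using () renaming (interchange to +-interchange)
  open import Algebra.Properties.CommutativeSemigroup *-commutativeSemigroup
    using () renaming (interchange to *-interchange)
  open import Algebra.Solver.Ring.AlmostCommutativeRing using (fromCommutativeRing; _-Raw-AlmostCommutative⟶_)
  open import Relation.Binary.Reasoning.Setoid setoid

  ⟦_⟧ : ℤ → Carrier
  ⟦ ℤ.+ n ⟧    = n × 1#
  ⟦ -[1+ n ] ⟧ = - (suc n × 1#)

  ⟦_⟧ˢ : Sign → Carrier
  ⟦ Sign.+ ⟧ˢ = 1#
  ⟦ Sign.- ⟧ˢ = - 1#

  x+y-[x+z]≈y-z : ∀ x y z → (x + y) - (x + z) ≈ y - z
  x+y-[x+z]≈y-z x y z = begin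
    (x + y) - (x + z)       ≈⟨ +-congˡ (-‿+-comm x z) ⟨
    (x + y) + (- x + - z)   ≈⟨ +-interchange x y (- x) (- z) ⟩
    (x - x) + (y - z)       ≈⟨ +-congʳ (-‿inverseʳ x) ⟩
    0# + (y - z)            ≈⟨ +-identityˡ (y - z) ⟩
    y - z                   ∎

  ⊖-homo : ∀ m n → ⟦ m ⊖ n ⟧ ≈ m × 1# - n × 1#
  ⊖-homo m       zero    = sym (trans (+-congˡ -0#≈0#) (+-identityʳ _))
  ⊖-homo zero    (suc n) = sym (+-identityˡ _)
  ⊖-homo (suc m) (suc n) = begin
    ⟦ suc m ⊖ suc n ⟧                 ≡⟨ ≡.cong ⟦_⟧ ([1+m]⊖[1+n]≡m⊖n m n) ⟩
    ⟦ m ⊖ n ⟧                         ≈⟨ ⊖-homo m n ⟩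
    m × 1# - n × 1#                   ≈⟨ x+y-[x+z]≈y-z 1# (m × 1#) (n × 1#) ⟨
    (1# + m × 1#) - (1# + n × 1#)     ≈⟨ +-cong (×-homo-+ 1# 1 m) (-‿cong (×-homo-+ 1# 1 n)) ⟨
    suc m × 1# - suc n × 1#           ∎

  +-homo : ∀ i j → ⟦ i ℤ.+ j ⟧ ≈ ⟦ i ⟧ + ⟦ j ⟧
  +-homo (ℤ.+ m)  (ℤ.+ n)  = ×-homo-+ 1# m n
  +-homo (ℤ.+ m)  -[1+ n ] = ⊖-homo m (suc n)
  +-homo -[1+ m ] (ℤ.+ n)  = trans (⊖-homo n (suc m)) (+-comm _ _)
  +-homo -[1+ m ] -[1+ n ] = begin
    - (suc (suc (m ℕ.+ n)) × 1#)      ≡⟨ ≡.cong (λ k → - (suc k × 1#)) (≡.sym (+-suc m n)) ⟩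
    - ((suc m ℕ.+ suc n) × 1#)        ≈⟨ -‿cong (×-homo-+ 1# (suc m) (suc n)) ⟩
    - (suc m × 1# + suc n × 1#)       ≈⟨ -‿+-comm _ _ ⟨
    ⟦ -[1+ m ] ⟧ + ⟦ -[1+ n ] ⟧       ∎

  -‿homo : ∀ i → ⟦ ℤ.- i ⟧ ≈ - ⟦ i ⟧
  -‿homo (ℤ.+ zero) = sym -0#≈0#
  -‿homo +[1+ n ]   = refl
  -‿homo -[1+ n ]   = sym (-‿involutive _)

  ◃-homo : ∀ s n → ⟦ s ◃ n ⟧ ≈ ⟦ s ⟧ˢ * (n × 1#)
  ◃-homo Sign.+ n = begin
    ⟦ Sign.+ ◃ n ⟧     ≡⟨ ≡.cong ⟦_⟧ (+◃n≡+n n) ⟩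
    n × 1#             ≈⟨ *-identityˡ _ ⟨
    1# * (n × 1#)      ∎
  ◃-homo Sign.- n = begin
    ⟦ Sign.- ◃ n ⟧     ≡⟨ ≡.cong ⟦_⟧ (-◃n≡-n n) ⟩
    ⟦ ℤ.- (ℤ.+ n) ⟧    ≈⟨ -‿homo (ℤ.+ n) ⟩
    - (n × 1#)         ≈⟨ -1*x≈-x _ ⟨
    - 1# * (n × 1#)    ∎

  sign-abs : ∀ i → ⟦ i ⟧ ≈ ⟦ sign i ⟧ˢ * (∣ i ∣ × 1#)
  sign-abs i = begin
    ⟦ i ⟧                   ≡⟨ ≡.cong ⟦_⟧ (◃-inverse i) ⟨
    ⟦ sign i ◃ ∣ i ∣ ⟧      ≈⟨ ◃-homo (sign i) ∣ i ∣ ⟩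
    ⟦ sign i ⟧ˢ * (∣ i ∣ × 1#) ∎

  sign-*-homo : ∀ s t → ⟦ s Sign.* t ⟧ˢ ≈ ⟦ s ⟧ˢ * ⟦ t ⟧ˢ
  sign-*-homo Sign.+ t      = sym (*-identityˡ _)
  sign-*-homo Sign.- Sign.+ = sym (*-identityʳ _)
  sign-*-homo Sign.- Sign.- = sym (trans (-1*x≈-x (- 1#)) (-‿involutive 1#))

  *-homo : ∀ i j → ⟦ i ℤ.* j ⟧ ≈ ⟦ i ⟧ * ⟦ j ⟧
  *-homo i j = begin
    ⟦ i ℤ.* j ⟧
      ≈⟨ ◃-homo (sign i Sign.* sign j) (∣ i ∣ ℕ.* ∣ j ∣) ⟩
    ⟦ sign i Sign.* sign j ⟧ˢ * ((∣ i ∣ ℕ.* ∣ j ∣) × 1#)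
      ≈⟨ *-cong (sign-*-homo (sign i) (sign j)) (×1-homo-* ∣ i ∣ ∣ j ∣) ⟩
    (⟦ sign i ⟧ˢ * ⟦ sign j ⟧ˢ) * ((∣ i ∣ × 1#) * (∣ j ∣ × 1#))
      ≈⟨ *-interchange _ _ _ _ ⟩
    (⟦ sign i ⟧ˢ * (∣ i ∣ × 1#)) * (⟦ sign j ⟧ˢ * (∣ j ∣ × 1#))
      ≈⟨ *-cong (sign-abs i) (sign-abs j) ⟨
    ⟦ i ⟧ * ⟦ j ⟧ ∎

  homomorphism : ℤ.+-*-rawRing -Raw-AlmostCommutative⟶ fromCommutativeRing R
  homomorphism = record
    { ⟦_⟧    = ⟦_⟧
    ; +-homo = +-homo
    ; *-homo = *-homo
    ; -‿homo = -‿homo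
    ; 0-homo = refl
    ; 1-homo = refl
    }

  open import Algebra.Solver.Ring ℤ.+-*-rawRing (fromCommutativeRing R) homomorphism
    (λ i j → Maybe.map (λ i≡j → reflexive (≡.cong ⟦_⟧ i≡j)) (dec⇒maybe (i ℤ≟ j)))
    public using (solve; _:=_; con; _:+_; _:*_; :-_; _:-_)

module _ (R : RealField) where
  open RealField R
  open import Data.Product as Product using (_×_; _,_)
  open import Relation.Binary.PropositionalEquality
    using (_≡_; _≢_; refl; sym; trans; cong; cong₂; subst; subst₂; module ≡-Reasoning)
  open Cube R
  open IsStrictTotalOrder isStrictTotalOrder using (compare)
    renaming (trans to <-trans; irrefl to <-irrefl)

  commutativeRing : CommutativeRing _ _
  commutativeRing = record { isCommutativeRing = isCommutativeRing }

  open CommutativeRing commutativeRing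
    using (_-_; *-comm; *-assoc; +-identityˡ; +-identityʳ;
           *-identityˡ; -‿inverseʳ; distribˡ; zeroˡ; zeroʳ;
           +-commutativeSemigroup)
  open import Algebra.Properties.CommutativeSemigroup +-commutativeSemigroup
    using () renaming (interchange to +-interchange)
  open IntegerCoefficients commutativeRing

  pos⇒≢0 : ∀ {x} → 0# < x → x ≢ 0#
  pos⇒≢0 0<x x≡0 = <-irrefl (sym x≡0) 0<x

  +-pos : ∀ {x y} → 0# < x → 0# < y → 0# < x + y
  +-pos {x} {y} 0<x 0<y =
    <-trans (subst (0# <_) (sym (+-identityˡ y)) 0<y) (+-mono-< 0# x y 0<x)

  neg⇒-pos : ∀ {x} → x < 0# → 0# < - x
  neg⇒-pos {x} x<0 = subst₂ _<_ (-‿inverseʳ x) (+-identityˡ (- x)) (+-mono-< x 0# (- x) x<0)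

  -pos⇒≯0 : ∀ {x} → 0# < - x → ¬ (0# < x)
  -pos⇒≯0 {x} 0<-x 0<x = <-irrefl refl (subst (0# <_) (-‿inverseʳ x) (+-pos 0<x 0<-x))

  0<y-x⇒x<y : ∀ {x y} → 0# < y - x → x < y
  0<y-x⇒x<y {x} {y} 0<y-x = subst₂ _<_ (+-identityˡ x) y-x+x≡y (+-mono-< 0# (y - x) x 0<y-x)
    where
    y-x+x≡y : y - x + x ≡ y
    y-x+x≡y = solve 2 (λ x y → y :- x :+ x := y) refl x y

  ≮0∧≢0⇒pos : ∀ {x} → ¬ (x < 0#) → x ≢ 0# → 0# < x
  ≮0∧≢0⇒pos {x} x≮0 x≢0 with compare x 0#
  ... | tri< x<0 _ _ = ⊥-elim (x≮0 x<0)
  ... | tri≈ _ x≡0 _ = ⊥-elim (x≢0 x≡0)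
  ... | tri> _ _ 0<x = 0<x

  ≢0⇒sq-pos : ∀ {x} → x ≢ 0# → 0# < x * x
  ≢0⇒sq-pos {x} x≢0 with compare x 0#
  ... | tri< x<0 _ _ = subst (0# <_) (solve 1 (λ x → :- x :* :- x := x :* x) refl x)
                             (*-pos _ _ (neg⇒-pos x<0) (neg⇒-pos x<0))
  ... | tri≈ _ x≡0 _ = ⊥-elim (x≢0 x≡0)
  ... | tri> _ _ 0<x = *-pos x x 0<x 0<x

  *-cancelˡ-pos : ∀ {x y} → 0# < x → 0# < x * y → 0# < y
  *-cancelˡ-pos {x} {y} 0<x 0<xy with compare y 0#
  ... | tri< y<0 _ _ = ⊥-elim (-pos⇒≯0 (subst (0# <_) (solve 2 (λ x y → x :* :- y := :- (x :* y)) refl x y)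
                                                 (*-pos _ _ 0<x (neg⇒-pos y<0))) 0<xy)
  ... | tri≈ _ y≡0 _ = ⊥-elim (pos⇒≢0 0<xy (trans (cong (x *_) y≡0) (zeroʳ x)))
  ... | tri> _ _ 0<y = 0<y

  ⁻¹-pos : ∀ {x} → 0# < x → 0# < x ⁻¹
  ⁻¹-pos {x} 0<x = *-cancelˡ-pos 0<x (subst (0# <_) (sym (⁻¹-inverse x (pos⇒≢0 0<x))) 0<1)
    where
    0<1 : 0# < 1#
    0<1 = subst (0# <_) (*-identityˡ 1#) (≢0⇒sq-pos (λ 1≡0 → 0≢1 (sym 1≡0)))

  opposite-signs⇒-*-pos : ∀ {x y} → x ≢ 0# → y ≢ 0# →
                          (x < 0# × ¬ (y < 0#)) ⊎ (¬ (x < 0#) × y < 0#) → 0# < - (x * y)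
  opposite-signs⇒-*-pos {x} {y} _ y≢0 (inj₁ (x<0 , y≮0)) =
    subst (0# <_) (solve 2 (λ x y → :- x :* y := :- (x :* y)) refl x y)
      (*-pos _ _ (neg⇒-pos x<0) (≮0∧≢0⇒pos y≮0 y≢0))
  opposite-signs⇒-*-pos {x} {y} x≢0 _ (inj₂ (x≮0 , y<0)) =
    subst (0# <_) (solve 2 (λ x y → x :* :- y := :- (x :* y)) refl x y)
      (*-pos _ _ (≮0∧≢0⇒pos x≮0 x≢0) (neg⇒-pos y<0))

  sumF-cong : ∀ {n} {f g : Fin n → Carrier} → (∀ k → f k ≡ g k) → sumF f ≡ sumF g
  sumF-cong {zero}  f≗g = refl
  sumF-cong {suc n} f≗g = cong₂ _+_ (f≗g zero) (sumF-cong (λ k → f≗g (suc k)))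

  sumF-0 : ∀ {n} (f : Fin n → Carrier) → (∀ k → f k ≡ 0#) → sumF f ≡ 0#
  sumF-0 {zero}  f f≗0 = refl
  sumF-0 {suc n} f f≗0 =
    trans (cong₂ _+_ (f≗0 zero) (sumF-0 (λ k → f (suc k)) (λ k → f≗0 (suc k)))) (+-identityˡ 0#)

  sumF-+ : ∀ {n} (f g : Fin n → Carrier) → sumF (λ k → f k + g k) ≡ sumF f + sumF g
  sumF-+ {zero}  f g = sym (+-identityˡ 0#)
  sumF-+ {suc n} f g =
    trans (cong (f zero + g zero +_) (sumF-+ (λ k → f (suc k)) (λ k → g (suc k))))
          (+-interchange (f zero) (g zero) _ _)

  sumF-*ˡ : ∀ {n} x (f : Fin n → Carrier) → sumF (λ k → x * f k) ≡ x * sumF f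
  sumF-*ˡ {zero}  x f = sym (zeroʳ x)
  sumF-*ˡ {suc n} x f =
    trans (cong (x * f zero +_) (sumF-*ˡ x (λ k → f (suc k)))) (sym (distribˡ x _ _))

  sumF-*ʳ : ∀ {n} x (f : Fin n → Carrier) → sumF (λ k → f k * x) ≡ sumF f * x
  sumF-*ʳ x f = trans (sumF-cong (λ k → *-comm (f k) x)) (trans (sumF-*ˡ x f) (*-comm x _))

  sumF-single : ∀ {n} (i : Fin n) (f : Fin n → Carrier) → (∀ k → k ≢ i → f k ≡ 0#) → sumF f ≡ f i
  sumF-single zero    f f≗0 =
    trans (cong (f zero +_) (sumF-0 _ (λ k → f≗0 (suc k) (λ ())))) (+-identityʳ (f zero))
  sumF-single (suc i) f f≗0 =
    trans (cong₂ _+_ (f≗0 zero (λ ()))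
                     (sumF-single i (λ k → f (suc k)) (λ k k≢i → f≗0 (suc k) (k≢i ∘ suc-injective))))
          (+-identityˡ (f (suc i)))

  sumF-comm : ∀ {m n} (f : Fin m → Fin n → Carrier) →
              sumF (λ k → sumF (λ l → f k l)) ≡ sumF (λ l → sumF (λ k → f k l))
  sumF-comm {zero} {n} f = sym (sumF-0 {n} _ (λ _ → refl))
  sumF-comm {suc m} f =
    trans (cong (sumF (f zero) +_) (sumF-comm (λ k → f (suc k)))) (sym (sumF-+ (f zero) _))

  identity-diag : ∀ {n} (k : Fin n) → identity k k ≡ 1#
  identity-diag k with k ≟ k
  ... | yes _   = refl
  ... | no  k≢k = ⊥-elim (k≢k refl)

  identity-off : ∀ {n} {k l : Fin n} → k ≢ l → identity k l ≡ 0#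
  identity-off {k = k} {l} k≢l with k ≟ l
  ... | yes k≡l = ⊥-elim (k≢l k≡l)
  ... | no  _   = refl

  identity-▷ : ∀ {n} (x : Vector n) k → (identity ▷ x) k ≡ x k
  identity-▷ x k = trans (sumF-single k _ off-k) (trans (cong (_* x k) (identity-diag k)) (*-identityˡ (x k)))
    where
    off-k : ∀ l → l ≢ k → identity k l * x l ≡ 0#
    off-k l l≢k = trans (cong (_* x l) (identity-off (l≢k ∘ sym))) (zeroˡ (x l))

  ▷-cong : ∀ {n} {A B : Matrix n} {x y : Vector n} → (∀ k l → A k l ≡ B k l) → (∀ k → x k ≡ y k) →
           ∀ k → (A ▷ x) k ≡ (B ▷ y) k
  ▷-cong A≗B x≗y k = sumF-cong (λ l → cong₂ _*_ (A≗B k l) (x≗y l))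

  ▷-assoc : ∀ {n} (A B : Matrix n) (x : Vector n) k → (A ▷ (B ▷ x)) k ≡ ((A · B) ▷ x) k
  ▷-assoc A B x k = begin
    sumF (λ l → A k l * sumF (λ m → B l m * x m))
      ≡⟨ sumF-cong (λ l → sym (sumF-*ˡ (A k l) (λ m → B l m * x m))) ⟩
    sumF (λ l → sumF (λ m → A k l * (B l m * x m)))
      ≡⟨ sumF-comm (λ l m → A k l * (B l m * x m)) ⟩
    sumF (λ m → sumF (λ l → A k l * (B l m * x m)))
      ≡⟨ sumF-cong (λ m → trans (sumF-cong (λ l → sym (*-assoc (A k l) (B l m) (x m))))
                                (sumF-*ʳ (x m) (λ l → A k l * B l m))) ⟩
    sumF (λ m → sumF (λ l → A k l * B l m) * x m) ∎
    where open ≡-Reasoning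

  inverse-solves : ∀ {n} {A B : Matrix n} → IsInverse A B → ∀ x k → (A ▷ (B ▷ x)) k ≡ x k
  inverse-solves {A = A} {B} (AB≡I , _) x k =
    trans (▷-assoc A B x k) (trans (▷-cong AB≡I (λ _ → refl) k) (identity-▷ x k))

  inverse-▷-unique : ∀ {n} {A B C : Matrix n} → IsInverse A B → IsInverse A C →
                     ∀ x k → (B ▷ x) k ≡ (C ▷ x) k
  inverse-▷-unique {A = A} {B} {C} (_ , BA≡I) A⁻¹≡C x k = begin
    (B ▷ x) k               ≡⟨ ▷-cong {A = B} (λ _ _ → refl) (λ l → sym (inverse-solves A⁻¹≡C x l)) k ⟩
    (B ▷ (A ▷ (C ▷ x))) k   ≡⟨ ▷-assoc B A (C ▷ x) k ⟩
    ((B · A) ▷ (C ▷ x)) k   ≡⟨ ▷-cong BA≡I (λ _ → refl) k ⟩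
    (identity ▷ (C ▷ x)) k  ≡⟨ identity-▷ (C ▷ x) k ⟩
    (C ▷ x) k               ∎
    where open ≡-Reasoning

  ∈φ⇒< : ∀ {n} {M : Matrix n} {q V B} → IsInverse (M[ M ] V) B →
         ∀ {j} → j ∈φ[ M , q ] V → (B ▷ q) j < 0#
  ∈φ⇒< {q = q} inv (C , invC , Cq<0) = subst (_< 0#) (sym (inverse-▷-unique inv invC q _)) Cq<0

  M[∅]≡identity : ∀ {n} (M : Matrix n) k l → M[ M ] ∅ k l ≡ identity k l
  M[∅]≡identity M k l rewrite lookup-replicate l false = refl

  -- (A · B) k l is (A ▷ λ p → B p l) k by definition.
  M[∅]-inverse : ∀ {n} (M : Matrix n) → IsInverse (M[ M ] ∅) identity
  M[∅]-inverse M =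
    (λ k l → trans (▷-cong (M[∅]≡identity M) (λ _ → refl) k) (identity-▷ (λ p → identity p l) k)) ,
    (λ k l → trans (identity-▷ (λ p → M[ M ] ∅ p l) k) (M[∅]≡identity M k l))

  ∈φ[∅]⇒< : ∀ {n} {M : Matrix n} {q j} → j ∈φ[ M , q ] ∅ → q j < 0#
  ∈φ[∅]⇒< {M = M} {q} {j} j∈φ = subst (_< 0#) (identity-▷ q j) (∈φ⇒< {V = ∅} (M[∅]-inverse M) j∈φ)

  <⇒∈φ[∅] : ∀ {n} {M : Matrix n} {q j} → q j < 0# → j ∈φ[ M , q ] ∅
  <⇒∈φ[∅] {M = M} {q} {j} qj<0 = identity , M[∅]-inverse M , subst (_< 0#) (sym (identity-▷ q j)) qj<0

  Generic⇒≢0 : ∀ {n} {M : Matrix n} {q} → Generic M q → ∀ j → q j ≢ 0#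
  Generic⇒≢0 {M = M} {q} gen j qj≡0 = gen ∅ identity (M[∅]-inverse M) j (trans (identity-▷ q j) qj≡0)

  rankOneUpdate : ∀ {n} → Fin n → Vector n → Matrix n
  rankOneUpdate i a k l = identity k l + a k * identity i l

  rankOneUpdate-▷ : ∀ {n} i (a x : Vector n) k → (rankOneUpdate i a ▷ x) k ≡ x k + a k * x i
  rankOneUpdate-▷ i a x k = begin
    sumF (λ l → (identity k l + a k * identity i l) * x l)
      ≡⟨ sumF-cong (λ l → distrib (identity k l) (a k) (identity i l) (x l)) ⟩
    sumF (λ l → identity k l * x l + a k * (identity i l * x l))
      ≡⟨ sumF-+ (λ l → identity k l * x l) (λ l → a k * (identity i l * x l)) ⟩
    (identity ▷ x) k + sumF (λ l → a k * (identity i l * x l))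
      ≡⟨ cong₂ _+_ (identity-▷ x k) (trans (sumF-*ˡ (a k) (λ l → identity i l * x l)) (cong (a k *_) (identity-▷ x i))) ⟩
    x k + a k * x i ∎
    where
    open ≡-Reasoning
    distrib : ∀ e a e′ x → (e + a * e′) * x ≡ e * x + a * (e′ * x)
    distrib = solve 4 (λ e a e′ x → (e :+ a :* e′) :* x := e :* x :+ a :* (e′ :* x)) refl

  rankOneUpdate-inverse : ∀ {n} i (a b : Vector n) → (∀ k → a k + b k + a k * b i ≡ 0#) →
                          ∀ k l → (rankOneUpdate i a · rankOneUpdate i b) k l ≡ identity k l
  rankOneUpdate-inverse i a b cancel k l = begin
    (rankOneUpdate i a · rankOneUpdate i b) k l
      ≡⟨ rankOneUpdate-▷ i a (λ p → rankOneUpdate i b p l) k ⟩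
    (identity k l + b k * identity i l) + a k * (identity i l + b i * identity i l)
      ≡⟨ collect (identity k l) (a k) (b k) (b i) (identity i l) ⟩
    identity k l + (a k + b k + a k * b i) * identity i l
      ≡⟨ cong (λ t → identity k l + t * identity i l) (cancel k) ⟩
    identity k l + 0# * identity i l
      ≡⟨ trans (cong (identity k l +_) (zeroˡ (identity i l))) (+-identityʳ (identity k l)) ⟩
    identity k l ∎
    where
    open ≡-Reasoning
    collect : ∀ e aₖ bₖ bᵢ e′ → (e + bₖ * e′) + aₖ * (e′ + bᵢ * e′) ≡ e + (aₖ + bₖ + aₖ * bᵢ) * e′
    collect = solve 5 (λ e aₖ bₖ bᵢ e′ → (e :+ bₖ :* e′) :+ aₖ :* (e′ :+ bᵢ :* e′)
                                       := e :+ (aₖ :+ bₖ :+ aₖ :* bᵢ) :* e′) refl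

  -- M(⁅i⁆) = I + a eᵢᵀ = rankOneUpdate i a for a = - Mᵢ - eᵢ
  columnUpdate : ∀ {n} → Matrix n → Fin n → Vector n
  columnUpdate M i k = - M k i - identity k i

  M[⁅i⁆]≡rankOneUpdate : ∀ {n} (M : Matrix n) i k l →
                         M[ M ] ⁅ i ⁆ k l ≡ rankOneUpdate i (columnUpdate M i) k l
  M[⁅i⁆]≡rankOneUpdate M i k l with lookup ⁅ i ⁆ l in l∈?⁅i⁆
  ... | true with refl ← x∈⁅y⁆⇒x≡y i (lookup⇒[]= l ⁅ i ⁆ l∈?⁅i⁆) =
    trans (solve 2 (λ m e → :- m := e :+ (:- m :- e) :* con (ℤ.+ 1)) refl (M k l) (identity k l))
          (cong (λ t → identity k l + columnUpdate M l k * t) (sym (identity-diag l)))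
  ... | false = sym (trans (cong (λ t → identity k l + columnUpdate M i k * t) (identity-off i≢l))
                           (trans (cong (identity k l +_) (zeroʳ _)) (+-identityʳ _)))
    where
    i≢l : i ≢ l
    i≢l refl with () ← trans (sym ([]=⇒lookup (x∈⁅x⁆ i))) l∈?⁅i⁆

  M[⁅i⁆]-inverse : ∀ {n} (M : Matrix n) i → M i i ≢ 0# →
                   IsInverse (M[ M ] ⁅ i ⁆) (rankOneUpdate i (λ k → columnUpdate M i k * M i i ⁻¹))
  M[⁅i⁆]-inverse M i Mᵢᵢ≢0 =
    (λ k l → trans (▷-cong (M[⁅i⁆]≡rankOneUpdate M i) (λ _ → refl) k)
                   (rankOneUpdate-inverse i a b a+b+abᵢ≡0 k l)) ,
    (λ k l → trans (▷-cong {A = rankOneUpdate i b} (λ _ _ → refl) (λ p → M[⁅i⁆]≡rankOneUpdate M i p l) k)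
                   (rankOneUpdate-inverse i b a b+a+baᵢ≡0 k l))
    where
    a b : Vector _
    a = columnUpdate M i
    b = λ k → a k * M i i ⁻¹
    aᵢ≡-Mᵢᵢ-1 : a i ≡ - M i i - 1#
    aᵢ≡-Mᵢᵢ-1 = cong (λ t → - M i i - t) (identity-diag i)
    x[1-mu]≡0 : ∀ x → x * (1# - M i i * M i i ⁻¹) ≡ 0#
    x[1-mu]≡0 x = trans (cong (λ t → x * (1# - t)) (⁻¹-inverse (M i i) Mᵢᵢ≢0))
                        (solve 1 (λ x → x :* (con (ℤ.+ 1) :- con (ℤ.+ 1)) := con (ℤ.+ 0)) refl x)
    a+b+abᵢ≡0 : ∀ k → a k + b k + a k * b i ≡ 0#
    a+b+abᵢ≡0 k = trans (cong (λ t → a k + b k + a k * (t * M i i ⁻¹)) aᵢ≡-Mᵢᵢ-1)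
      (trans (solve 3 (λ x m u → x :+ x :* u :+ x :* ((:- m :- con (ℤ.+ 1)) :* u)
                                 := x :* (con (ℤ.+ 1) :- m :* u)) refl (a k) (M i i) (M i i ⁻¹))
             (x[1-mu]≡0 (a k)))
    b+a+baᵢ≡0 : ∀ k → b k + a k + b k * a i ≡ 0#
    b+a+baᵢ≡0 k = trans (cong (λ t → b k + a k + b k * t) aᵢ≡-Mᵢᵢ-1)
      (trans (solve 3 (λ x m u → x :* u :+ x :+ x :* u :* (:- m :- con (ℤ.+ 1))
                                 := x :* (con (ℤ.+ 1) :- m :* u)) refl (a k) (M i i) (M i i ⁻¹))
             (x[1-mu]≡0 (a k)))

  M[⁅i⁆]-equation : ∀ {n} (M : Matrix n) q i {B} → IsInverse (M[ M ] ⁅ i ⁆) B →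
                    ∀ k → q k ≡ (B ▷ q) k + columnUpdate M i k * (B ▷ q) i
  M[⁅i⁆]-equation M q i {B} inv k = begin
    q k                                               ≡⟨ inverse-solves inv q k ⟨
    (M[ M ] ⁅ i ⁆ ▷ (B ▷ q)) k                        ≡⟨ ▷-cong (M[⁅i⁆]≡rankOneUpdate M i) (λ _ → refl) k ⟩
    (rankOneUpdate i (columnUpdate M i) ▷ (B ▷ q)) k  ≡⟨ rankOneUpdate-▷ i (columnUpdate M i) (B ▷ q) k ⟩
    (B ▷ q) k + columnUpdate M i k * (B ▷ q) i        ∎
    where open ≡-Reasoning

  M[⁅i⁆]-pivot : ∀ {n} (M : Matrix n) q i {B} → IsInverse (M[ M ] ⁅ i ⁆) B →
                 q i ≡ - (M i i * (B ▷ q) i)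
  M[⁅i⁆]-pivot M q i {B} inv =
    trans (M[⁅i⁆]-equation M q i inv i)
      (trans (cong (λ t → y i + (- M i i - t) * y i) (identity-diag i))
             (solve 2 (λ y m → y :+ (:- m :- con (ℤ.+ 1)) :* y := :- (m :* y)) refl (y i) (M i i)))
    where
    y = B ▷ q

  M[⁅i⁆]-off-pivot : ∀ {n} (M : Matrix n) q i {B} → IsInverse (M[ M ] ⁅ i ⁆) B →
                     ∀ {j} → j ≢ i → q j ≡ (B ▷ q) j - M j i * (B ▷ q) i
  M[⁅i⁆]-off-pivot M q i {B} inv {j} j≢i =
    trans (M[⁅i⁆]-equation M q i inv j)
      (trans (cong (λ t → y j + (- M j i - t) * y i) (identity-off j≢i))
             (solve 3 (λ yⱼ m yᵢ → yⱼ :+ (:- m :- con (ℤ.+ 0)) :* yᵢ := yⱼ :- m :* yᵢ) refl (y j) (M j i) (y i)))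
    where
    y = B ▷ q

  pairVector : ∀ {n} → Carrier → Fin n → Carrier → Fin n → Vector n
  pairVector α i β j l = α * identity i l + β * identity j l

  sumF-pairVector : ∀ {n} α i β j (f : Vector n) → sumF (λ l → pairVector α i β j l * f l) ≡ α * f i + β * f j
  sumF-pairVector α i β j f = begin
    sumF (λ l → (α * identity i l + β * identity j l) * f l)
      ≡⟨ sumF-cong (λ l → distrib α (identity i l) β (identity j l) (f l)) ⟩
    sumF (λ l → α * (identity i l * f l) + β * (identity j l * f l))
      ≡⟨ sumF-+ (λ l → α * (identity i l * f l)) (λ l → β * (identity j l * f l)) ⟩
    sumF (λ l → α * (identity i l * f l)) + sumF (λ l → β * (identity j l * f l))
      ≡⟨ cong₂ _+_ (sumF-*ˡ α (λ l → identity i l * f l)) (sumF-*ˡ β (λ l → identity j l * f l)) ⟩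
    α * (identity ▷ f) i + β * (identity ▷ f) j
      ≡⟨ cong₂ (λ s t → α * s + β * t) (identity-▷ f i) (identity-▷ f j) ⟩
    α * f i + β * f j ∎
    where
    open ≡-Reasoning
    distrib : ∀ α e β e′ x → (α * e + β * e′) * x ≡ α * (e * x) + β * (e′ * x)
    distrib = solve 5 (λ α e β e′ x → (α :* e :+ β :* e′) :* x := α :* (e :* x) :+ β :* (e′ :* x)) refl

  quadraticForm-pairVector : ∀ {n} (M : Matrix n) α i β j → let x = pairVector α i β j in
    sumF (λ k → x k * (M ▷ x) k) ≡ α * (α * M i i + β * M i j) + β * (α * M j i + β * M j j)
  quadraticForm-pairVector M α i β j =
    trans (sumF-pairVector α i β j (M ▷ x)) (cong₂ (λ s t → α * s + β * t) (M▷x i) (M▷x j))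
    where
    x = pairVector α i β j
    M▷x : ∀ k → (M ▷ x) k ≡ α * M k i + β * M k j
    M▷x k = trans (sumF-cong (λ l → *-comm (M k l) (x l))) (sumF-pairVector α i β j (M k))

  diagonal-pos : ∀ {n} {M : Matrix n} → PositiveDefinite M → ∀ j → 0# < M j j
  diagonal-pos {M = M} pd j = subst (0# <_) form≡Mⱼⱼ (pd (pairVector 1# j 0# j) x≢0)
    where
    form≡Mⱼⱼ : sumF (λ k → pairVector 1# j 0# j k * (M ▷ pairVector 1# j 0# j) k) ≡ M j j
    form≡Mⱼⱼ = trans (quadraticForm-pairVector M 1# j 0# j)
      (solve 1 (λ m → con (ℤ.+ 1) :* (con (ℤ.+ 1) :* m :+ con (ℤ.+ 0) :* m)
                      :+ con (ℤ.+ 0) :* (con (ℤ.+ 1) :* m :+ con (ℤ.+ 0) :* m) := m) refl (M j j))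
    x≢0 : ¬ (∀ l → pairVector 1# j 0# j l ≡ 0#)
    x≢0 x≡0 = 0≢1 (trans (sym (x≡0 j)) (trans (cong (λ e → 1# * e + 0# * e) (identity-diag j))
      (solve 0 (con (ℤ.+ 1) :* con (ℤ.+ 1) :+ con (ℤ.+ 0) :* con (ℤ.+ 1) := con (ℤ.+ 1)) refl)))

  -- xᵀ M x = Mⱼⱼ (Mᵢᵢ Mⱼⱼ - Mⱼᵢ²) for x = Mⱼⱼ eᵢ - Mⱼᵢ eⱼ
  principalMinor-pos : ∀ {n} {M : Matrix n} → Symmetric M → PositiveDefinite M →
                       ∀ {i j} → i ≢ j → 0# < M i i * M j j - M j i * M j i
  principalMinor-pos {M = M} sym-M pd {i} {j} i≢j =
    *-cancelˡ-pos (diagonal-pos pd j) (subst (0# <_) form≡ (pd x x≢0))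
    where
    x = pairVector (M j j) i (- M j i) j
    form≡ : sumF (λ k → x k * (M ▷ x) k) ≡ M j j * (M i i * M j j - M j i * M j i)
    form≡ = trans (quadraticForm-pairVector M (M j j) i (- M j i) j)
      (trans (cong (λ t → M j j * (M j j * M i i + - M j i * t) + - M j i * (M j j * M j i + - M j i * M j j))
                   (sym-M i j))
             (solve 3 (λ mᵢ mⱼ c → mⱼ :* (mⱼ :* mᵢ :+ :- c :* c) :+ :- c :* (mⱼ :* c :+ :- c :* mⱼ)
                                   := mⱼ :* (mᵢ :* mⱼ :- c :* c)) refl (M i i) (M j j) (M j i)))
    x≢0 : ¬ (∀ l → x l ≡ 0#)
    x≢0 x≡0 = pos⇒≢0 (diagonal-pos pd j) (trans (sym xᵢ≡Mⱼⱼ) (x≡0 i))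
      where
      xᵢ≡Mⱼⱼ : x i ≡ M j j
      xᵢ≡Mⱼⱼ = trans (cong₂ (λ s t → M j j * s + - M j i * t) (identity-diag i) (identity-off (i≢j ∘ sym)))
                     (solve 2 (λ m c → m :* con (ℤ.+ 1) :+ :- c :* con (ℤ.+ 0) := m) refl (M j j) (M j i))

  -- mⱼ (qᵢ²/mᵢ - qⱼ²/mⱼ) = (mᵢmⱼ - c²) yᵢ² - 2 qⱼyⱼ + yⱼ² once qᵢ and qⱼ are expressed through y
  potential-step : ∀ {mᵢ mⱼ c yᵢ yⱼ qᵢ qⱼ} → 0# < mᵢ → 0# < mⱼ → 0# < mᵢ * mⱼ - c * c →
                   yᵢ ≢ 0# → 0# < - (qⱼ * yⱼ) → qᵢ ≡ - (mᵢ * yᵢ) → qⱼ ≡ yⱼ - c * yᵢ →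
                   qⱼ * qⱼ * mⱼ ⁻¹ < qᵢ * qᵢ * mᵢ ⁻¹
  potential-step {mᵢ} {mⱼ} {c} {yᵢ} {yⱼ} 0<mᵢ 0<mⱼ 0<det yᵢ≢0 0<-qⱼyⱼ refl refl =
    0<y-x⇒x<y (subst (0# <_) (sym difference≡) (*-pos _ _ (⁻¹-pos 0<mⱼ) 0<bracket))
    where
    qⱼ = yⱼ - c * yᵢ
    bracket = (mᵢ * mⱼ - c * c) * (yᵢ * yᵢ) + (- (qⱼ * yⱼ) + - (qⱼ * yⱼ)) + yⱼ * yⱼ
    yⱼ≢0 : yⱼ ≢ 0#
    yⱼ≢0 yⱼ≡0 = pos⇒≢0 0<-qⱼyⱼ (trans (cong (λ y → - (qⱼ * y)) yⱼ≡0)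
                                      (solve 1 (λ q → :- (q :* con (ℤ.+ 0)) := con (ℤ.+ 0)) refl qⱼ))
    0<bracket : 0# < bracket
    0<bracket = +-pos (+-pos (*-pos _ _ 0<det (≢0⇒sq-pos yᵢ≢0)) (+-pos 0<-qⱼyⱼ 0<-qⱼyⱼ)) (≢0⇒sq-pos yⱼ≢0)
    difference≡ : - (mᵢ * yᵢ) * - (mᵢ * yᵢ) * mᵢ ⁻¹ - qⱼ * qⱼ * mⱼ ⁻¹ ≡ mⱼ ⁻¹ * bracket
    difference≡ = begin
      - (mᵢ * yᵢ) * - (mᵢ * yᵢ) * mᵢ ⁻¹ - qⱼ * qⱼ * mⱼ ⁻¹
        ≡⟨ cong (_- qⱼ * qⱼ * mⱼ ⁻¹)
                (solve 3 (λ m u y → :- (m :* y) :* :- (m :* y) :* u := (m :* u) :* (m :* y :* y)) refl mᵢ (mᵢ ⁻¹) yᵢ) ⟩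
      (mᵢ * mᵢ ⁻¹) * (mᵢ * yᵢ * yᵢ) - qⱼ * qⱼ * mⱼ ⁻¹
        ≡⟨ cong (λ t → t * (mᵢ * yᵢ * yᵢ) - qⱼ * qⱼ * mⱼ ⁻¹)
                (trans (⁻¹-inverse mᵢ (pos⇒≢0 0<mᵢ)) (sym (⁻¹-inverse mⱼ (pos⇒≢0 0<mⱼ)))) ⟩
      (mⱼ * mⱼ ⁻¹) * (mᵢ * yᵢ * yᵢ) - qⱼ * qⱼ * mⱼ ⁻¹
        ≡⟨ solve 6 (λ m m′ w y y′ c →
                      (m′ :* w) :* (m :* y :* y) :- (y′ :- c :* y) :* (y′ :- c :* y) :* w
                      := w :* ((m :* m′ :- c :* c) :* (y :* y)
                               :+ (:- ((y′ :- c :* y) :* y′) :+ :- ((y′ :- c :* y) :* y′)) :+ y′ :* y′)) refl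
                   mᵢ mⱼ (mⱼ ⁻¹) yᵢ yⱼ c ⟩
      mⱼ ⁻¹ * bracket ∎
      where open ≡-Reasoning

  potential : ∀ {n} → Matrix n → Vector n → Fin n → Carrier
  potential M q k = q k * q k * M k k ⁻¹

  module _ {n} {M : Matrix n} {q : Vector n}
           (sym-M : Symmetric M) (pd : PositiveDefinite M) (gen : Generic M q) where

    LArc∅⇒potential-< : ∀ {i j} → LArc∅ M q i j → potential M q j < potential M q i
    LArc∅⇒potential-< {i} {j} (i≢j , j∈φ∅⊕φ⁅i⁆) =
      potential-step (diagonal-pos pd i) (diagonal-pos pd j) (principalMinor-pos sym-M pd i≢j)
        (gen ⁅ i ⁆ B B-inv i) (opposite-signs⇒-*-pos (Generic⇒≢0 gen j) (gen ⁅ i ⁆ B B-inv j) signs)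
        (M[⁅i⁆]-pivot M q i B-inv) (M[⁅i⁆]-off-pivot M q i B-inv (i≢j ∘ sym))
      where
      B = rankOneUpdate i (λ k → columnUpdate M i k * M i i ⁻¹)
      B-inv = M[⁅i⁆]-inverse M i (pos⇒≢0 (diagonal-pos pd i))
      signs : (q j < 0# × ¬ ((B ▷ q) j < 0#)) ⊎ (¬ (q j < 0#) × (B ▷ q) j < 0#)
      signs = Sum.map (Product.map ∈φ[∅]⇒< (λ j∉φ⁅i⁆ yⱼ<0 → j∉φ⁅i⁆ (B , B-inv , yⱼ<0)))
                      (Product.map (λ j∉φ∅ qⱼ<0 → j∉φ∅ (<⇒∈φ[∅] qⱼ<0)) (∈φ⇒< {V = ⁅ i ⁆} B-inv))
                      j∈φ∅⊕φ⁅i⁆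

    TransClosure-LArc∅⇒potential-< : ∀ {i j} → TransClosure (LArc∅ M q) i j →
                                     potential M q j < potential M q i
    TransClosure-LArc∅⇒potential-< [ arc ]      = LArc∅⇒potential-< arc
    TransClosure-LArc∅⇒potential-< (arc ∷ path) =
      <-trans (TransClosure-LArc∅⇒potential-< path) (LArc∅⇒potential-< arc)

    LArc∅-acyclic : Acyclic (LArc∅ M q)
    LArc∅-acyclic i cycle = <-irrefl refl (TransClosure-LArc∅⇒potential-< cycle)

lemma2 : (R : RealField) → let open Cube R in
         (n : ℕ) → 1 ≤ n → (M : Matrix n) → (q : Vector n) →
         Symmetric M → PositiveDefinite M → Generic M q →
         Acyclic (LArc∅ M q)
lemma2 R n _ M q = LArc∅-acyclic R
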